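{- Let $G=(V,E)$ be a simple graph with $n=|V|\ge 1$ vertices. Run the algorithm EqDSatur described below, initialized with an equitable $UB_0$-coloring $\overline{c}$ of $G$ (so the global variable $UB$ starts at $UB_0$), an integer $LB\le\chi_{eq}(G)$, and a maximal clique $Q=\{v_1,\ldots,v_q\}$ of $G$, by calling $\textsc{Node}(\Pi_Q)$. Then, regardless of the rule used to choose the vertex $u$ in Step 2, the recursion terminates and at the end the global variable $UB$ equals $\chi_{eq}(G)$ and $\overline{c}$ is an equitable $\chi_{eq}(G)$-coloring of $G$.
   Context: A $k$-coloring of $G$ is a partition of $V$ into $k$ non-empty stable sets $C_1,\ldots,C_k$. An equitable $k$-coloring ($k$-eqcol) is a $k$-coloring with $\bigl||C_i|-|C_j|\bigr|\le1$ for all $i,j$; $\chi_{eq}(G)$ is the minimum $k$ for which $G$ has a $k$-eqcol. A partial $k$-coloring is a tuple $\Pi=(k,C_1,\ldots,C_n,U,F)$ with $k$ a positive integer, $C_1,\ldots,C_n$ pairwise disjoint stable sets with $C_j\ne\varnothing$ iff $j\le k$, $U=V\setminus\bigcup_{j=1}^kC_j$, and for $u\in U$, $F(u)=\{j\in\{1,\ldots,n\}:\text{no vertex of }C_j\text{ is adjacent to }u\}$. For $u\in U$ and $j\in\{1,\ldots,k+1\}$, $\langle u,j\rangle\hookrightarrow\Pi$ denotes the partial coloring $(k',C'_1,\ldots,C'_n,U',F')$ with $k'=\max\{j,k\}$, $C'_j=C_j\cup\{u\}$, $C'_r=C_r$ for $r\ne j$, $U'=U\setminus\{u\}$, $F'(v)=F(v)\setminus\{j\}$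 for $v\in U'$ adjacent to $u$ and $F'(v)=F(v)$ otherwise. For the clique $Q=\{v_1,\ldots,v_q\}$, $\Pi_Q$ is the partial $q$-coloring with $C_i=\{v_i\}$ for $1\le i\le q$, $C_i=\varnothing$ for $i>q$, and $U=V\setminus Q$. For a partial $k$-coloring $\Pi$ with $M=\max_{1\le r\le k}|C_r|$ and current value $UB$, property (P.1) is $|U|\ge\sum_{r=1}^k\bigl(\max\{M-1,\lfloor n/(UB-1)\rfloor\}-|C_r|\bigr)^+$ (where $x^+=\max\{x,0\}$), and property (P.2) is $M\le\lceil n/\max\{k,LB\}\rceil$. The procedure $\textsc{Node}(\Pi)$ for $\Pi=(k,C_1,\ldots,C_n,U,F)$, with $UB$ and $\overline{c}$ global variables, is: Step 1: if $U=\varnothing$, set $UB\leftarrow k$, $\overline{c}\leftarrow\Pi$ and return. Step 2: select a vertex $u\in U$. Step 3: for each color $j$ with $1\le j\le\min\{k+1,UB-1\}$ and $j\in F(u)$ (in any order), set $\Pi'=(k',C'_1,\ldots,C'_n,U',F')\leftarrow\langle u,j\rangle\hookrightarrow\Pi$, and if $F'(v)\ne\varnothing$ for all $v\in U'$ and $\Pi'$ satisfies (P.1) and (P.2) (with respect to the current value of $UB$), execute $\textsc{Node}(\Pi')$. -}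

module Defs where

open import Data.Nat using (ℕ; zero; suc; _+_; _∸_; _≤_; _⊔_; _⊓_; _/_)
import Data.Nat as ℕ
open import Data.Fin using (Fin)
import Data.Fin as Fin
open import Data.List using (List; []; _∷_; length; filter; map; foldr; upTo; allFin)
open import Data.Nat.ListAction using (sum)
open import Data.List.Membership.Propositional using (_∈_; _∉_)
open import Data.List.Relation.Unary.Unique.Propositional using (Unique)
open import Data.List.Relation.Binary.Permutation.Propositional using (_↭_)
open import Data.Product using (Σ; ∃; _×_; _,_)
open import Data.Bool using (if_then_else_)
open import Relation.Nullary using (¬_; does)
open import Relation.Binary using (Decidable)
open import Relation.Binary.PropositionalEquality using (_≡_; _≢_)

record Graph (n : ℕ) : Set₁ where
  field
    Adj   : Fin n → Fin n → Set
    adj?  : Decidable Adj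
    sym   : ∀ {u v} → Adj u v → Adj v u
    irrefl : ∀ {u} → ¬ Adj u u

-- ⌊a / b⌋ ; the value for b = 0 is irrelevant (never used by the algorithm)
divFloor : ℕ → ℕ → ℕ
divFloor a zero    = 0
divFloor a (suc b) = a / suc b

-- ⌈a / b⌉ ; the value for b = 0 is irrelevant (never used by the algorithm)
divCeil : ℕ → ℕ → ℕ
divCeil a zero    = 0
divCeil a (suc b) = (a + b) / suc b

range1 : ℕ → List ℕ
range1 m = map suc (upTo m)

maxList : List ℕ → ℕ
maxList = foldr _⊔_ 0

-- Colour assignments: c : Fin n → ℕ, colour 0 means "uncoloured",
-- colour j ≥ 1 means "vertex is in C_j".

-- |C_r| = |{ v : c v = r }|   (r = 0 gives |U| for partial colourings)
classSize : ∀ {n} → (Fin n → ℕ) → ℕ → ℕ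
classSize {n} c r = length (filter (λ v → c v ℕ.≟ r) (allFin n))

module _ {n : ℕ} (G : Graph n) where
  open Graph G

  IsEqCol : ℕ → (Fin n → ℕ) → Set
  IsEqCol k c =
      (∀ v → 1 ≤ c v × c v ≤ k)
    × (∀ j → 1 ≤ j → j ≤ k → ∃ λ v → c v ≡ j)
    × (∀ u v → Adj u v → c u ≢ c v)
    × (∀ i j → 1 ≤ i → i ≤ k → 1 ≤ j → j ≤ k → classSize c i ≤ suc (classSize c j))

  EqColorable : ℕ → Set
  EqColorable k = ∃ λ c → IsEqCol k c

  IsChiEq : ℕ → Set
  IsChiEq k = EqColorable k × (∀ k′ → EqColorable k′ → k ≤ k′)

  IsMaximalClique : List (Fin n) → Set
  IsMaximalClique Q =
      Unique Q
    × (∀ {u v} → u ∈ Q → v ∈ Q → u ≢ v → Adj u v)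
    × (∀ w → w ∉ Q → ∃ λ u → u ∈ Q × ¬ Adj w u)

-- Partial colourings  Π = (k, C_1,...,C_n, U, F)
-- represented by k and the assignment col (C_j = col⁻¹(j), U = col⁻¹(0));
-- F is computed from col.

record PCol (n : ℕ) : Set where
  constructor pcol
  field
    k   : ℕ
    col : Fin n → ℕ
open PCol public

record State (n : ℕ) : Set where
  constructor state
  field
    UB   : ℕ
    cbar : Fin n → ℕ
open State public

-- 1-based position of v in the list Q, 0 if v ∉ Q
indexOf : ∀ {n} → List (Fin n) → Fin n → ℕ
indexOf []       v = 0
indexOf (w ∷ ws) v = if does (w Fin.≟ v) then 1 else (if does (indexOf ws v ℕ.≟ 0) then 0 else suc (indexOf ws v))

-- Π_Q : C_i = {v_i} for 1 ≤ i ≤ q, U = V ∖ Q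
PiQ : ∀ {n} → List (Fin n) → PCol n
PiQ Q = pcol (length Q) (indexOf Q)

assign : ∀ {n} → Fin n → ℕ → PCol n → PCol n
assign u j Π = pcol (k Π ⊔ j) (λ v → if does (v Fin.≟ u) then j else col Π v)

module _ {n : ℕ} (G : Graph n) where
  open Graph G

  Uncol : PCol n → Fin n → Set
  Uncol Π v = col Π v ≡ 0

  AllColored : PCol n → Set
  AllColored Π = ∀ v → col Π v ≢ 0

  InF : PCol n → Fin n → ℕ → Set
  InF Π u j = 1 ≤ j × j ≤ n × (∀ w → col Π w ≡ j → ¬ Adj u w)

  FNonempty : PCol n → Fin n → Set
  FNonempty Π v = ∃ λ j → InF Π v j

  maxClass : PCol n → ℕ
  maxClass Π = maxList (map (classSize (col Π)) (range1 (k Π)))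

  P1 : ℕ → PCol n → Set
  P1 ub Π = sum (map (λ r → ((maxClass Π ∸ 1) ⊔ divFloor n (ub ∸ 1)) ∸ classSize (col Π) r)
                     (range1 (k Π)))
            ≤ classSize (col Π) 0

  P2 : ℕ → PCol n → Set
  P2 lb Π = maxClass Π ≤ divCeil n (k Π ⊔ lb)

  -- A vertex-selection rule (Step 2) together with the order in which the
  -- colours are tried (Step 3); both may depend on the global state and Π.
  record Rule : Set where
    field
      sel : State n → PCol n → Fin n
      ord : State n → PCol n → Fin n → List ℕ
  open Rule

  ValidRule : Rule → Set
  ValidRule R =
      (∀ s Π → ¬ AllColored Π → Uncol Π (sel R s Π))
    × (∀ s Π u → ord R s Π u ↭ range1 (suc (k Π)))

  -- Big-step semantics of EqDSatur:
  --   Node  R lb Π s s'      : calling Node(Π) with globals s ends with globals s'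
  --   Loop  R lb Π u js s s' : running the loop of Step 3 over colours js
  module Semantics (lb : ℕ) (R : Rule) where

    -- the condition under which Node(⟨u,j⟩ ↪ Π) is executed, w.r.t. current UB
    Cond : PCol n → Fin n → ℕ → State n → Set
    Cond Π u j s =
        1 ≤ j × j ≤ (suc (k Π) ⊓ (UB s ∸ 1))
      × InF Π u j
      × (∀ v → Uncol (assign u j Π) v → FNonempty (assign u j Π) v)
      × P1 (UB s) (assign u j Π)
      × P2 lb (assign u j Π)

    mutual
      data Node (Π : PCol n) (s : State n) : State n → Set where
        leaf : AllColored Π → Node Π s (state (k Π) (col Π))
        branch : ∀ {s′} → ¬ AllColored Π
               → Loop Π (sel R s Π) (ord R s Π (sel R s Π)) s s′
               → Node Π s s′

      data Loop (Π : PCol n) (u : Fin n) : List ℕ → State n → State n → Set where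
        stop : ∀ {s} → Loop Π u [] s s
        skip : ∀ {j js s s′} → ¬ Cond Π u j s → Loop Π u js s s′ → Loop Π u (j ∷ js) s s′
        call : ∀ {j js s s′ s″} → Cond Π u j s
             → Node (assign u j Π) s s′ → Loop Π u js s′ s″ → Loop Π u (j ∷ js) s s″

-- The proof has three independent parts.
--  * Termination: every recursive call colours one more vertex, so the number
--    |U| of uncoloured vertices is a measure; as all tests are decidable the
--    run can be computed by recursion on |U| (Search.run).
--  * Soundness: along every branch the partial colouring stays proper and
--    shaped, and (P.1) makes it equitable once complete; hence every leaf, and
--    therefore every value of (UB, c̄), is an equitable colouring (Search.sound).
--    Moreover UB never increases (Search.ub-decreases).
--  * Optimality: for any equitable k*-colouring c* with LB ≤ k* < UB, call a
--    partial colouring compatible with c* when each of its classes lies in a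
--    distinct class of c*.  Π_Q is compatible, a compatible Π always has a
--    compatible child, and while UB > k* this child passes all tests of Step 3
--    (counting arguments on the equitable c*, Compatibility); so the search
--    follows it until UB ≤ k* (Search.Optimality.reaches).

module Submission where

open import Data.Nat
open import Data.Nat.Properties
open import Data.Nat.DivMod using (m<n*o⇒m/o<n; /-monoʳ-≤; /-monoˡ-≤; m*n/n≡m)
open import Data.Nat.ListAction using (sum)
open import Data.Fin using (Fin; toℕ; fromℕ<)
import Data.Fin as Fin
import Data.Fin.Properties as Finₚ
open import Data.Product using (Σ; ∃; _×_; _,_; proj₁; proj₂)
open import Data.Sum using (_⊎_; inj₁; inj₂)
open import Data.List using (List; []; _∷_; length; filter; map; upTo; allFin)
open import Data.List.Properties using (length-map; length-applyUpTo; length-tabulate)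
open import Data.List.Membership.Propositional using (_∈_)
open import Data.List.Membership.Propositional.Properties
  using (∈-map⁺; ∈-map⁻; ∈-upTo⁺; ∈-upTo⁻; ∈-allFin)
open import Data.List.Relation.Unary.Any using (here; there)
open import Data.List.Relation.Unary.All.Properties using (All¬⇒¬Any)
open import Data.List.Relation.Unary.AllPairs using ([]; _∷_)
open import Data.List.Relation.Unary.Unique.Propositional using (Unique)
open import Data.List.Relation.Binary.Permutation.Propositional using (↭-sym)
open import Data.List.Relation.Binary.Permutation.Propositional.Properties using (∈-resp-↭)
import Data.List.Relation.Unary.Unique.Propositional.Properties as Uniqueₚ
open import Data.Empty using (⊥-elim)
open import Relation.Nullary using (Dec; yes; no; ¬_)
open import Relation.Nullary.Decidable using (_×-dec_; _→-dec_; ¬?; map′)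
open import Relation.Binary.PropositionalEquality
open import Defs

open import Algebra.Properties.CommutativeSemigroup +-commutativeSemigroup
  using () renaming (interchange to +-interchange)

∑ : ∀ {a} {A : Set a} → List A → (A → ℕ) → ℕ
∑ xs f = sum (map f xs)

𝟙 : ∀ {P : Set} → Dec P → ℕ
𝟙 (yes _) = 1
𝟙 (no _)  = 0

module _ {a} {A : Set a} where

  count≡∑𝟙 : ∀ {P : A → Set} (P? : ∀ x → Dec (P x)) xs →
             length (filter P? xs) ≡ ∑ xs (λ x → 𝟙 (P? x))
  count≡∑𝟙 P? []       = refl
  count≡∑𝟙 P? (x ∷ xs) with P? x
  ... | yes _ = cong suc (count≡∑𝟙 P? xs)
  ... | no  _ = count≡∑𝟙 P? xs

  ∑-mono : ∀ xs {f g : A → ℕ} → (∀ x → x ∈ xs → f x ≤ g x) → ∑ xs f ≤ ∑ xs g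
  ∑-mono []       f≤g = z≤n
  ∑-mono (x ∷ xs) f≤g = +-mono-≤ (f≤g x (here refl)) (∑-mono xs (λ y y∈ → f≤g y (there y∈)))

  ∑-cong : ∀ xs {f g : A → ℕ} → (∀ x → x ∈ xs → f x ≡ g x) → ∑ xs f ≡ ∑ xs g
  ∑-cong []       f≡g = refl
  ∑-cong (x ∷ xs) f≡g = cong₂ _+_ (f≡g x (here refl)) (∑-cong xs (λ y y∈ → f≡g y (there y∈)))

  ∑-+ : ∀ xs (f g : A → ℕ) → ∑ xs (λ x → f x + g x) ≡ ∑ xs f + ∑ xs g
  ∑-+ []       f g = refl
  ∑-+ (x ∷ xs) f g = begin
    f x + g x + ∑ xs (λ y → f y + g y) ≡⟨ cong (f x + g x +_) (∑-+ xs f g) ⟩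
    f x + g x + (∑ xs f + ∑ xs g)      ≡⟨ +-interchange (f x) (g x) (∑ xs f) (∑ xs g) ⟩
    f x + ∑ xs f + (g x + ∑ xs g)      ∎
    where open ≡-Reasoning

  ∑-const : ∀ (xs : List A) c → ∑ xs (λ _ → c) ≡ length xs * c
  ∑-const []       c = refl
  ∑-const (x ∷ xs) c = cong (c +_) (∑-const xs c)

  term≤∑ : ∀ {xs} (f : A → ℕ) {x} → x ∈ xs → f x ≤ ∑ xs f
  term≤∑ f (here refl) = m≤m+n _ _
  term≤∑ {y ∷ ys} f (there x∈) = ≤-trans (term≤∑ f x∈) (m≤n+m _ (f y))

  ∑-mono-< : ∀ xs {f g : A → ℕ} {y} → y ∈ xs → (∀ x → x ∈ xs → f x ≤ g x) →
             f y < g y → ∑ xs f < ∑ xs g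
  ∑-mono-< (x ∷ xs) (here refl) f≤g fy<gy =
    +-mono-<-≤ fy<gy (∑-mono xs (λ z z∈ → f≤g z (there z∈)))
  ∑-mono-< (x ∷ xs) (there y∈) f≤g fy<gy =
    +-mono-≤-< (f≤g x (here refl)) (∑-mono-< xs y∈ (λ z z∈ → f≤g z (there z∈)) fy<gy)

  ∑-zero : ∀ xs (f : A → ℕ) → (∀ x → x ∈ xs → f x ≡ 0) → ∑ xs f ≡ 0
  ∑-zero []       f f≡0 = refl
  ∑-zero (x ∷ xs) f f≡0 rewrite f≡0 x (here refl) = ∑-zero xs f (λ y y∈ → f≡0 y (there y∈))

module _ {a b} {A : Set a} {B : Set b} where

  ∑-swap : ∀ (xs : List A) (ys : List B) (f : A → B → ℕ) →
           ∑ xs (λ x → ∑ ys (f x)) ≡ ∑ ys (λ y → ∑ xs (λ x → f x y))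
  ∑-swap []       ys f = sym (∑-zero ys _ (λ _ _ → refl))
  ∑-swap (x ∷ xs) ys f = begin
    ∑ ys (f x) + ∑ xs (λ x′ → ∑ ys (f x′))           ≡⟨ cong (∑ ys (f x) +_) (∑-swap xs ys f) ⟩
    ∑ ys (f x) + ∑ ys (λ y → ∑ xs (λ x′ → f x′ y))  ≡⟨ ∑-+ ys (f x) _ ⟨
    ∑ ys (λ y → f x y + ∑ xs (λ x′ → f x′ y))        ∎
    where open ≡-Reasoning

𝟙≤1 : ∀ {P : Set} (d : Dec P) → 𝟙 d ≤ 1
𝟙≤1 (yes _) = ≤-refl
𝟙≤1 (no _)  = z≤n

𝟙-yes : ∀ {P : Set} (d : Dec P) → P → 𝟙 d ≡ 1
𝟙-yes (yes _) _ = refl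
𝟙-yes (no ¬p) p = ⊥-elim (¬p p)

𝟙-no : ∀ {P : Set} (d : Dec P) → ¬ P → 𝟙 d ≡ 0
𝟙-no (yes p) ¬p = ⊥-elim (¬p p)
𝟙-no (no _)  _  = refl

𝟙≡1⇒ : ∀ {P : Set} (d : Dec P) → 𝟙 d ≡ 1 → P
𝟙≡1⇒ (yes p) _ = p

𝟙-mono : ∀ {P R : Set} (d : Dec P) (e : Dec R) → (P → R) → 𝟙 d ≤ 𝟙 e
𝟙-mono (no _)  e       P⇒R = z≤n
𝟙-mono (yes p) (yes _) P⇒R = ≤-refl
𝟙-mono (yes p) (no ¬r) P⇒R = ⊥-elim (¬r (P⇒R p))

𝟙-split : ∀ {P R S : Set} (d : Dec P) (e : Dec R) (f : Dec S) → (P → R ⊎ S) → 𝟙 d ≤ 𝟙 e + 𝟙 f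
𝟙-split (no _)  e f P⇒R⊎S = z≤n
𝟙-split (yes p) e f P⇒R⊎S with P⇒R⊎S p
... | inj₁ r = ≤-trans (≤-reflexive (sym (𝟙-yes e r))) (m≤m+n _ _)
... | inj₂ s = ≤-trans (≤-reflexive (sym (𝟙-yes f s))) (m≤n+m _ _)

≤𝟙 : ∀ {P : Set} {x} (d : Dec P) → (P → x ≤ 1) → (¬ P → x ≤ 0) → x ≤ 𝟙 d
≤𝟙 (yes p) x≤1 _ = x≤1 p
≤𝟙 (no ¬p) _ x≤0 = x≤0 ¬p

∑-atMostOne : ∀ {a} {A : Set a} (xs : List A) (f : A → ℕ) → Unique xs → (∀ x → f x ≤ 1) →
              (∀ x y → x ∈ xs → y ∈ xs → f x ≡ 1 → f y ≡ 1 → x ≡ y) → ∑ xs f ≤ 1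
∑-atMostOne []       f _ _ _ = z≤n
∑-atMostOne (x ∷ xs) f (x∉xs ∷ uniq) f≤1 one with f x in fx | f≤1 x
... | zero  | _ = ∑-atMostOne xs f uniq f≤1 (λ y z y∈ z∈ → one y z (there y∈) (there z∈))
... | suc (suc _) | s≤s ()
... | suc zero | _ = ≤-reflexive (cong suc (∑-zero xs f rest))
  where
  rest : ∀ y → y ∈ xs → f y ≡ 0
  rest y y∈ with f y in fy | f≤1 y
  ... | zero     | _ = refl
  ... | suc (suc _) | s≤s ()
  ... | suc zero | _ = ⊥-elim (All¬⇒¬Any x∉xs (subst (_∈ xs) (one y x (there y∈) (here refl) fy fx) y∈))

range1⁺ : ∀ {k r} → 1 ≤ r → r ≤ k → r ∈ range1 k
range1⁺ {r = suc r} _ r≤k = ∈-map⁺ suc (∈-upTo⁺ r≤k)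

range1⁻ : ∀ {k r} → r ∈ range1 k → 1 ≤ r × r ≤ k
range1⁻ r∈ with ∈-map⁻ suc r∈
... | i , i∈ , refl = s≤s z≤n , ∈-upTo⁻ i∈

length-range1 : ∀ k → length (range1 k) ≡ k
length-range1 k = trans (length-map suc (upTo k)) (length-applyUpTo (λ i → i) k)

unique-range1 : ∀ k → Unique (range1 k)
unique-range1 k = Uniqueₚ.map⁺ suc-injective (Uniqueₚ.upTo⁺ k)

maxList-upper : ∀ {xs x} → x ∈ xs → x ≤ maxList xs
maxList-upper {y ∷ ys} (here refl) = m≤m⊔n y (maxList ys)
maxList-upper {y ∷ ys} (there x∈)  = ≤-trans (maxList-upper x∈) (m≤n⊔m y (maxList ys))

maxList-least : ∀ xs {b} → (∀ x → x ∈ xs → x ≤ b) → maxList xs ≤ b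
maxList-least []       _   = z≤n
maxList-least (x ∷ xs) xs≤ = ⊔-lub (xs≤ x (here refl)) (maxList-least xs (λ y y∈ → xs≤ y (there y∈)))

MapsInto : ℕ → ℕ → (ℕ → ℕ) → Set
MapsInto a b σ = ∀ i → 1 ≤ i → i ≤ a → 1 ≤ σ i × σ i ≤ b

InjectiveOn : ℕ → (ℕ → ℕ) → Set
InjectiveOn a σ = ∀ i j → 1 ≤ i → i ≤ a → 1 ≤ j → j ≤ a → σ i ≡ σ j → i ≡ j

pigeonhole : ∀ a b σ → MapsInto a b σ → InjectiveOn a σ → a ≤ b
pigeonhole a b σ into inj = Finₚ.injective⇒≤ {f = f} f-injective
  where
  image-range : ∀ (i : Fin a) → 1 ≤ σ (suc (toℕ i)) × σ (suc (toℕ i)) ≤ b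
  image-range i = into (suc (toℕ i)) (s≤s z≤n) (Finₚ.toℕ<n i)

  pred< : ∀ {m} → 1 ≤ m × m ≤ b → pred m < b
  pred< {suc m} (_ , m<b) = m<b

  f : Fin a → Fin b
  f i = fromℕ< (pred< (image-range i))

  f-injective : ∀ {i j} → f i ≡ f j → i ≡ j
  f-injective {i} {j} fi≡fj = Finₚ.toℕ-injective (suc-injective (inj _ _ (s≤s z≤n) (Finₚ.toℕ<n i)
    (s≤s z≤n) (Finₚ.toℕ<n j)
    (pred-injective ⦃ >-nonZero (proj₁ (image-range i)) ⦄ ⦃ >-nonZero (proj₁ (image-range j)) ⦄ pred≡)))
    where
    pred≡ : pred (σ (suc (toℕ i))) ≡ pred (σ (suc (toℕ j)))
    pred≡ = trans (sym (Finₚ.toℕ-fromℕ< _)) (trans (cong toℕ fi≡fj) (Finₚ.toℕ-fromℕ< _))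

Preimage : ℕ → (ℕ → ℕ) → ℕ → Set
Preimage k σ t = ∃ λ r → 1 ≤ r × r ≤ k × σ r ≡ t

preimage? : ∀ k σ t → Dec (Preimage k σ t)
preimage? k σ t = map′ (λ (r , r<1+k , 1≤r , σr≡t) → r , 1≤r , ≤-pred r<1+k , σr≡t)
                       (λ (r , 1≤r , r≤k , σr≡t) → r , s≤s r≤k , 1≤r , σr≡t)
                       (anyUpTo? (λ r → (1 ≤? r) ×-dec (σ r ≟ t)) (suc k))

extend : (ℕ → ℕ) → ℕ → ℕ → ℕ → ℕ
extend σ k t i with i ≟ suc k
... | yes _ = t
... | no _  = σ i

extend-new : ∀ σ k t → extend σ k t (suc k) ≡ t
extend-new σ k t with suc k ≟ suc k
... | yes _   = refl
... | no ≢    = ⊥-elim (≢ refl)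

extend-old : ∀ σ k t i → i ≤ k → extend σ k t i ≡ σ i
extend-old σ k t i i≤k with i ≟ suc k
... | yes refl = ⊥-elim (1+n≰n i≤k)
... | no _     = refl

extend-injective : ∀ σ k t → InjectiveOn k σ → ¬ Preimage k σ t → InjectiveOn (suc k) (extend σ k t)
extend-injective σ k t inj new i j 1≤i i≤ 1≤j j≤ same with i ≟ suc k | j ≟ suc k
... | yes i≡ | yes j≡ = trans i≡ (sym j≡)
... | yes _  | no j≢  = ⊥-elim (new (j , 1≤j , ≤-pred (≤∧≢⇒< j≤ j≢) , sym same))
... | no i≢  | yes _  = ⊥-elim (new (i , 1≤i , ≤-pred (≤∧≢⇒< i≤ i≢) , same))
... | no i≢  | no j≢  = inj i j 1≤i (≤-pred (≤∧≢⇒< i≤ i≢)) 1≤j (≤-pred (≤∧≢⇒< j≤ j≢)) same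

extend-into : ∀ σ k b t → MapsInto k b σ → 1 ≤ t × t ≤ b → MapsInto (suc k) b (extend σ k t)
extend-into σ k b t into t∈ i 1≤i i≤ with i ≤? k
... | yes i≤k = subst (λ x → 1 ≤ x × x ≤ b) (sym (extend-old σ k t i i≤k)) (into i 1≤i i≤k)
... | no i≰k  = subst (λ x → 1 ≤ x × x ≤ b)
                  (sym (trans (cong (extend σ k t) (≤-antisym i≤ (≰⇒> i≰k))) (extend-new σ k t))) t∈

<⇒≤∸1 : ∀ {m n} → m < n → m ≤ n ∸ 1
<⇒≤∸1 (s≤s m≤n) = m≤n

divFloor≤ : ∀ N k m → N < suc m * k → divFloor N k ≤ m
divFloor≤ N zero    m _  = z≤n
divFloor≤ N (suc k) m lt = ≤-pred (m<n*o⇒m/o<n lt)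

divFloor-antitone : ∀ N {a b} → 1 ≤ a → a ≤ b → divFloor N b ≤ divFloor N a
divFloor-antitone N {suc a} {suc b} _ a≤b = /-monoʳ-≤ N a≤b

≤divCeil : ∀ N K m → 1 ≤ K → m * K ≤ N + (K ∸ 1) → m ≤ divCeil N K
≤divCeil N (suc K) m _ mK≤ = ≤-trans (≤-reflexive (sym (m*n/n≡m m (suc K)))) (/-monoˡ-≤ (suc K) mK≤)

classSize-∑ : ∀ {n} (c : Fin n → ℕ) r → classSize c r ≡ ∑ (allFin n) (λ v → 𝟙 (c v ≟ r))
classSize-∑ {n} c r = count≡∑𝟙 (λ v → c v ≟ r) (allFin n)

∑classSize : ∀ {n} (c : Fin n → ℕ) k → (∀ v → 1 ≤ c v × c v ≤ k) → ∑ (range1 k) (classSize c) ≡ n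
∑classSize {n} c k c∈[1,k] = begin
  ∑ (range1 k) (classSize c)                               ≡⟨ ∑-cong (range1 k) (λ r _ → classSize-∑ c r) ⟩
  ∑ (range1 k) (λ r → ∑ (allFin n) (λ v → 𝟙 (c v ≟ r)))   ≡⟨ ∑-swap (range1 k) (allFin n) _ ⟩
  ∑ (allFin n) (λ v → ∑ (range1 k) (λ r → 𝟙 (c v ≟ r)))   ≡⟨ ∑-cong (allFin n) (λ v _ → oneClass v) ⟩
  ∑ (allFin n) (λ _ → 1)                                   ≡⟨ ∑-const (allFin n) 1 ⟩
  length (allFin n) * 1                                    ≡⟨ *-identityʳ _ ⟩
  length (allFin n)                                        ≡⟨ length-tabulate (λ v → v) ⟩
  n                                                        ∎
  where
  open ≡-Reasoning
  oneClass : ∀ v → ∑ (range1 k) (λ r → 𝟙 (c v ≟ r)) ≡ 1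
  oneClass v = ≤-antisym
    (∑-atMostOne (range1 k) _ (unique-range1 k) (λ r → 𝟙≤1 (c v ≟ r))
      (λ r r′ _ _ hit hit′ → trans (sym (𝟙≡1⇒ (c v ≟ r) hit)) (𝟙≡1⇒ (c v ≟ r′) hit′)))
    (≤-trans (≤-reflexive (sym (𝟙-yes (c v ≟ c v) refl)))
      (term≤∑ (λ r → 𝟙 (c v ≟ r)) (range1⁺ (proj₁ (c∈[1,k] v)) (proj₂ (c∈[1,k] v)))))

assign-at : ∀ {n} u j (Π : PCol n) → col (assign u j Π) u ≡ j
assign-at u j Π with u Fin.≟ u
... | yes _  = refl
... | no u≢u = ⊥-elim (u≢u refl)

assign-elsewhere : ∀ {n} u j (Π : PCol n) {v} → v ≢ u → col (assign u j Π) v ≡ col Π v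
assign-elsewhere u j Π {v} v≢u with v Fin.≟ u
... | yes v≡u = ⊥-elim (v≢u v≡u)
... | no _    = refl

-- Colouring an uncoloured vertex (with a colour j ≥ 1) decreases |U|;
-- this is the termination measure of the search.
uncoloured-decreases : ∀ {n} {Π : PCol n} {u j} → col Π u ≡ 0 → 1 ≤ j →
                       classSize (col (assign u j Π)) 0 < classSize (col Π) 0
uncoloured-decreases {n} {Π} {u} {j} u-uncol 1≤j = begin-strict
  classSize (col Π′) 0                    ≡⟨ classSize-∑ (col Π′) 0 ⟩
  ∑ (allFin n) (λ v → 𝟙 (col Π′ v ≟ 0))  <⟨ ∑-mono-< (allFin n) (∈-allFin u) pointwise at-u ⟩
  ∑ (allFin n) (λ v → 𝟙 (col Π v ≟ 0))   ≡⟨ classSize-∑ (col Π) 0 ⟨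
  classSize (col Π) 0                     ∎
  where
  open ≤-Reasoning
  Π′ = assign u j Π
  u-coloured : col Π′ u ≢ 0
  u-coloured = n>0⇒n≢0 (subst (1 ≤_) (sym (assign-at u j Π)) 1≤j)
  pointwise : ∀ v → v ∈ allFin n → 𝟙 (col Π′ v ≟ 0) ≤ 𝟙 (col Π v ≟ 0)
  pointwise v _ = 𝟙-mono (col Π′ v ≟ 0) (col Π v ≟ 0) uncoloured-before
    where
    uncoloured-before : col Π′ v ≡ 0 → col Π v ≡ 0
    uncoloured-before c′v≡0 = byCase (v Fin.≟ u)
      where
      byCase : Dec (v ≡ u) → col Π v ≡ 0
      byCase (yes v≡u) = ⊥-elim (u-coloured (subst (λ w → col Π′ w ≡ 0) v≡u c′v≡0))
      byCase (no v≢u)  = trans (sym (assign-elsewhere u j Π v≢u)) c′v≡0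
  at-u : 𝟙 (col Π′ u ≟ 0) < 𝟙 (col Π u ≟ 0)
  at-u rewrite 𝟙-no (col Π′ u ≟ 0) u-coloured | 𝟙-yes (col Π u ≟ 0) u-uncol = ≤-refl

record Shaped {n} (Π : PCol n) : Set where
  field
    bounded  : ∀ v → col Π v ≤ k Π
    nonEmpty : ∀ j → 1 ≤ j → j ≤ k Π → ∃ λ v → col Π v ≡ j

shaped-assign : ∀ {n} {Π : PCol n} {u j} → Shaped Π → col Π u ≡ 0 → 1 ≤ j → j ≤ suc (k Π) →
                Shaped (assign u j Π)
shaped-assign {Π = Π} {u} {j} sh u-uncol 1≤j j≤k+1 = record { bounded = bounded′ ; nonEmpty = nonEmpty′ }
  where
  open Shaped sh
  bounded′ : ∀ v → col (assign u j Π) v ≤ k Π ⊔ j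
  bounded′ v with v Fin.≟ u
  ... | yes _ = m≤n⊔m (k Π) j
  ... | no _  = ≤-trans (bounded v) (m≤m⊔n (k Π) j)
  nonEmpty′ : ∀ i → 1 ≤ i → i ≤ k Π ⊔ j → ∃ λ v → col (assign u j Π) v ≡ i
  nonEmpty′ i 1≤i i≤k′ with i ≤? k Π
  ... | yes i≤k = let (v , cv≡i) = nonEmpty i 1≤i i≤k in
        v , trans (assign-elsewhere u j Π (λ { refl → n>0⇒n≢0 1≤i (trans (sym cv≡i) u-uncol) })) cv≡i
  ... | no i≰k = u , trans (assign-at u j Π) (≤-antisym j≤i i≤j)
    where
    j≤i : j ≤ i
    j≤i = ≤-trans j≤k+1 (≰⇒> i≰k)
    i≤j : i ≤ j
    i≤j with j ≤? k Π
    ... | yes j≤k = ⊥-elim (i≰k (≤-trans i≤k′ (≤-reflexive (m≥n⇒m⊔n≡m j≤k))))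
    ... | no j≰k  = ≤-trans i≤k′ (≤-reflexive (m≤n⇒m⊔n≡n (<⇒≤ (≰⇒> j≰k))))

data IndexOfCons {n} (w : Fin n) (ws : List (Fin n)) (v : Fin n) : Set where
  found  : w ≡ v → indexOf (w ∷ ws) v ≡ 1 → IndexOfCons w ws v
  absent : w ≢ v → indexOf ws v ≡ 0 → indexOf (w ∷ ws) v ≡ 0 → IndexOfCons w ws v
  later  : w ≢ v → indexOf ws v ≢ 0 → indexOf (w ∷ ws) v ≡ suc (indexOf ws v) → IndexOfCons w ws v

indexOf-cons : ∀ {n} (w : Fin n) ws v → IndexOfCons w ws v
indexOf-cons w ws v with w Fin.≟ v | indexOf ws v ≟ 0
... | yes w≡v | _       = found w≡v (at-head w≡v)
  where
  at-head : w ≡ v → indexOf (w ∷ ws) v ≡ 1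
  at-head w≡v with w Fin.≟ v
  ... | yes _   = refl
  ... | no w≢v  = ⊥-elim (w≢v w≡v)
... | no w≢v  | yes i≡0 = absent w≢v i≡0 (not-found w≢v i≡0)
  where
  not-found : w ≢ v → indexOf ws v ≡ 0 → indexOf (w ∷ ws) v ≡ 0
  not-found w≢v i≡0 with w Fin.≟ v | indexOf ws v
  ... | yes w≡v | _     = ⊥-elim (w≢v w≡v)
  ... | no _    | zero  = refl
... | no w≢v  | no i≢0  = later w≢v i≢0 (in-tail w≢v i≢0)
  where
  in-tail : w ≢ v → indexOf ws v ≢ 0 → indexOf (w ∷ ws) v ≡ suc (indexOf ws v)
  in-tail w≢v i≢0 with w Fin.≟ v | indexOf ws v
  ... | yes w≡v | _     = ⊥-elim (w≢v w≡v)
  ... | no _    | zero  = ⊥-elim (i≢0 refl)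
  ... | no _    | suc _ = refl

indexOf≤length : ∀ {n} (Q : List (Fin n)) v → indexOf Q v ≤ length Q
indexOf≤length []       v = z≤n
indexOf≤length (w ∷ ws) v with indexOf-cons w ws v
... | found _ i≡1      = ≤-trans (≤-reflexive i≡1) (s≤s z≤n)
... | absent _ _ i≡0   = ≤-trans (≤-reflexive i≡0) z≤n
... | later _ _ i≡1+i′ = ≤-trans (≤-reflexive i≡1+i′) (s≤s (indexOf≤length ws v))

indexOf-injective : ∀ {n} (Q : List (Fin n)) v w → indexOf Q v ≡ indexOf Q w → indexOf Q v ≢ 0 → v ≡ w
indexOf-injective []       v w _ i≢0 = ⊥-elim (i≢0 refl)
indexOf-injective (x ∷ xs) v w same i≢0 with indexOf-cons x xs v | indexOf-cons x xs w
... | found x≡v _        | found x≡w _        = trans (sym x≡v) x≡w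
... | absent _ _ iv≡0    | _                  = ⊥-elim (i≢0 iv≡0)
... | _                  | absent _ _ iw≡0    = ⊥-elim (i≢0 (trans same iw≡0))
... | found _ iv≡1       | later _ i′≢0 iw≡   = ⊥-elim (i′≢0 (suc-injective (trans (sym iw≡) (trans (sym same) iv≡1))))
... | later _ i′≢0 iv≡   | found _ iw≡1       = ⊥-elim (i′≢0 (suc-injective (trans (sym iv≡) (trans same iw≡1))))
... | later _ i′≢0 iv≡   | later _ _ iw≡      =
  indexOf-injective xs v w (suc-injective (trans (sym iv≡) (trans same iw≡))) i′≢0

indexOf-onto : ∀ {n} (Q : List (Fin n)) → Unique Q → ∀ i → 1 ≤ i → i ≤ length Q →
               ∃ λ v → v ∈ Q × indexOf Q v ≡ i
indexOf-onto (w ∷ ws) _ (suc zero) _ _ with indexOf-cons w ws w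
... | found _ i≡1    = w , here refl , i≡1
... | absent w≢w _ _ = ⊥-elim (w≢w refl)
... | later w≢w _ _  = ⊥-elim (w≢w refl)
indexOf-onto (w ∷ ws) (w∉ws ∷ uniq) (suc (suc i)) _ (s≤s i<|ws|)
  with indexOf-onto ws uniq (suc i) (s≤s z≤n) i<|ws|
... | v , v∈ws , i′≡ with indexOf-cons w ws v
...   | found refl _    = ⊥-elim (All¬⇒¬Any w∉ws v∈ws)
...   | absent _ i′≡0 _ = ⊥-elim (0≢1+n (trans (sym i′≡0) i′≡))
...   | later _ _ i≡    = v , there v∈ws , trans i≡ (cong suc i′≡)

relabelQ : ∀ {n} → (Fin n → ℕ) → List (Fin n) → ℕ → ℕ
relabelQ c []       i             = 0
relabelQ c (w ∷ ws) zero          = 0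
relabelQ c (w ∷ ws) (suc zero)    = c w
relabelQ c (w ∷ ws) (suc (suc i)) = relabelQ c ws (suc i)

relabelQ-agrees : ∀ {n} (c : Fin n → ℕ) Q v → indexOf Q v ≢ 0 → c v ≡ relabelQ c Q (indexOf Q v)
relabelQ-agrees c []       v i≢0 = ⊥-elim (i≢0 refl)
relabelQ-agrees c (w ∷ ws) v i≢0 with indexOf-cons w ws v
... | found refl i≡1 rewrite i≡1 = refl
... | absent _ _ i≡0   = ⊥-elim (i≢0 i≡0)
... | later _ i′≢0 i≡ rewrite i≡ = shift (indexOf ws v) i′≢0 (relabelQ-agrees c ws v i′≢0)
  where
  shift : ∀ i → i ≢ 0 → c v ≡ relabelQ c ws i → c v ≡ relabelQ c (w ∷ ws) (suc i)
  shift zero    i≢0′ _ = ⊥-elim (i≢0′ refl)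
  shift (suc i) _    eq = eq

shaped-root : ∀ {n} {Q : List (Fin n)} → Unique Q → Shaped (PiQ Q)
shaped-root {Q = Q} uniq = record
  { bounded  = indexOf≤length Q
  ; nonEmpty = λ i 1≤i i≤q → let (v , _ , iv≡i) = indexOf-onto Q uniq i 1≤i i≤q in v , iv≡i
  }

singleton-classes : ∀ {n} (Q : List (Fin n)) i → 1 ≤ i → classSize (indexOf Q) i ≤ 1
singleton-classes {n} Q i 1≤i = begin
  classSize (indexOf Q) i                       ≡⟨ classSize-∑ (indexOf Q) i ⟩
  ∑ (allFin n) (λ v → 𝟙 (indexOf Q v ≟ i))     ≤⟨ ∑-atMostOne (allFin n) _ (Uniqueₚ.allFin⁺ n)
                                                     (λ v → 𝟙≤1 (indexOf Q v ≟ i)) samePosition ⟩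
  1                                             ∎
  where
  open ≤-Reasoning
  samePosition : ∀ v w → v ∈ allFin n → w ∈ allFin n →
                 𝟙 (indexOf Q v ≟ i) ≡ 1 → 𝟙 (indexOf Q w ≟ i) ≡ 1 → v ≡ w
  samePosition v w _ _ hit hit′ =
    let iv≡i = 𝟙≡1⇒ (indexOf Q v ≟ i) hit ; iw≡i = 𝟙≡1⇒ (indexOf Q w ≟ i) hit′ in
    indexOf-injective Q v w (trans iv≡i (sym iw≡i)) (λ iv≡0 → n>0⇒n≢0 1≤i (trans (sym iv≡i) iv≡0))

module _ {n : ℕ} (G : Graph n) where
  open Graph G renaming (sym to adj-sym)

  Proper : PCol n → Set
  Proper Π = ∀ v w → Adj v w → col Π v ≡ col Π w → col Π v ≡ 0

  proper-assign : ∀ {Π u j} → Proper Π → InF G Π u j → Proper (assign u j Π)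
  proper-assign {Π} {u} {j} proper (_ , _ , j-free) v w v~w same with v Fin.≟ u | w Fin.≟ u
  ... | yes refl | yes refl = ⊥-elim (irrefl v~w)
  ... | yes refl | no _     = ⊥-elim (j-free w (sym same) v~w)
  ... | no _     | yes refl = ⊥-elim (j-free v same (adj-sym v~w))
  ... | no _     | no _     = proper v w v~w same

  -- Once every vertex is coloured, (P.1) forces |C_i| ≤ |C_j| + 1: the sum of
  -- the deficits (T − |C_r|)⁺ is bounded by |U| = 0, so every class has size
  -- at least T ≥ M − 1, while every class has size at most M.
  P1⇒equitable : ∀ {ub} Π → P1 G ub Π → AllColored G Π → ∀ i j → 1 ≤ i → i ≤ k Π → 1 ≤ j → j ≤ k Π →
                 classSize (col Π) i ≤ suc (classSize (col Π) j)
  P1⇒equitable {ub} Π p1 all i j 1≤i i≤k 1≤j j≤k = begin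
    classSize (col Π) i   ≤⟨ maxList-upper (∈-map⁺ (classSize (col Π)) (range1⁺ 1≤i i≤k)) ⟩
    M                     ≤⟨ m≤n+m∸n M 1 ⟩
    suc (M ∸ 1)           ≤⟨ s≤s (m≤m⊔n (M ∸ 1) _) ⟩
    suc T                 ≤⟨ s≤s T≤Cj ⟩
    suc (classSize (col Π) j) ∎
    where
    open ≤-Reasoning
    M = maxClass G Π
    T = (M ∸ 1) ⊔ divFloor n (ub ∸ 1)
    noUncoloured : classSize (col Π) 0 ≡ 0
    noUncoloured = trans (classSize-∑ (col Π) 0) (∑-zero (allFin n) _ (λ v _ → 𝟙-no (col Π v ≟ 0) (all v)))
    T≤Cj : T ≤ classSize (col Π) j
    T≤Cj = m∸n≡0⇒m≤n (n≤0⇒n≡0 (≤-trans (term≤∑ (λ r → T ∸ classSize (col Π) r) (range1⁺ 1≤j j≤k))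
                                 (≤-trans p1 (≤-reflexive noUncoloured))))

  -- The invariant maintained along every branch of the search tree.
  record Valid (Π : PCol n) : Set where
    field
      shaped    : Shaped Π
      proper    : Proper Π
      equitable : AllColored G Π → ∀ i j → 1 ≤ i → i ≤ k Π → 1 ≤ j → j ≤ k Π →
                  classSize (col Π) i ≤ suc (classSize (col Π) j)
    open Shaped shaped public

  valid⇒eqCol : ∀ {Π} → Valid Π → AllColored G Π → IsEqCol G (k Π) (col Π)
  valid⇒eqCol {Π} valid all =
      (λ v → n≢0⇒n>0 (all v) , bounded v)
    , nonEmpty
    , (λ u v u~v same → all u (proper u v u~v same))
    , equitable all
    where open Valid valid

  -- Q is a clique.
  Clique : List (Fin n) → Set
  Clique Q = ∀ {u v} → u ∈ Q → v ∈ Q → u ≢ v → Adj u v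

  valid-root : ∀ {Q} → Unique Q → Valid (PiQ Q)
  valid-root {Q} uniq = record
    { shaped    = shaped-root uniq
    ; proper    = proper
    ; equitable = λ _ i j 1≤i _ _ _ → ≤-trans (singleton-classes Q i 1≤i) (s≤s z≤n)
    }
    where
    proper : Proper (PiQ Q)
    proper v w v~w same with indexOf Q v ≟ 0
    ... | yes iv≡0 = iv≡0
    ... | no iv≢0  = ⊥-elim (irrefl (subst (Adj v) (sym (indexOf-injective Q v w same iv≢0)) v~w))

  -- Counting facts about a fixed equitable k*-colouring c* of G; they are
  -- what makes a colouring compatible with c* pass the tests (P.1), (P.2).
  module EquitableCounting {c* : Fin n → ℕ} {k* : ℕ} (eqCol : IsEqCol G k* c*) where

    c*-range : ∀ v → 1 ≤ c* v × c* v ≤ k*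
    c*-range = proj₁ eqCol

    c*-onto : ∀ j → 1 ≤ j → j ≤ k* → ∃ λ v → c* v ≡ j
    c*-onto = proj₁ (proj₂ eqCol)

    c*-proper : ∀ u v → Adj u v → c* u ≢ c* v
    c*-proper = proj₁ (proj₂ (proj₂ eqCol))

    c*-balanced : ∀ i j → 1 ≤ i → i ≤ k* → 1 ≤ j → j ≤ k* → classSize c* i ≤ suc (classSize c* j)
    c*-balanced = proj₂ (proj₂ (proj₂ eqCol))

    C* : ℕ → ℕ
    C* = classSize c*

    ∑C*≡n : ∑ (range1 k*) C* ≡ n
    ∑C*≡n = ∑classSize c* k* c*-range

    -- k* ≤ n, since the k* classes are non-empty and partition V.
    k*≤n : k* ≤ n
    k*≤n = begin
      k*                     ≡⟨ length-range1 k* ⟨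
      length (range1 k*)     ≡⟨ *-identityʳ _ ⟨
      length (range1 k*) * 1 ≡⟨ ∑-const (range1 k*) 1 ⟨
      ∑ (range1 k*) (λ _ → 1) ≤⟨ ∑-mono (range1 k*) nonEmpty ⟩
      ∑ (range1 k*) C*       ≡⟨ ∑C*≡n ⟩
      n                      ∎
      where
      open ≤-Reasoning
      nonEmpty : ∀ r → r ∈ range1 k* → 1 ≤ C* r
      nonEmpty r r∈ with c*-onto r (proj₁ (range1⁻ r∈)) (proj₂ (range1⁻ r∈))
      ... | v , c*v≡r = begin
        1                            ≡⟨ 𝟙-yes (c* v ≟ r) c*v≡r ⟨
        𝟙 (c* v ≟ r)                 ≤⟨ term≤∑ (λ w → 𝟙 (c* w ≟ r)) (∈-allFin v) ⟩
        ∑ (allFin n) (λ w → 𝟙 (c* w ≟ r)) ≡⟨ classSize-∑ c* r ⟨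
        C* r                         ∎

    -- Every class of c* has at least ⌊n/k*⌋ vertices:
    -- n = Σ_r |C*_r| < Σ_r (|C*_x| + 1) = k*·(|C*_x| + 1).
    ⌊n/k*⌋≤C* : ∀ x → 1 ≤ x → x ≤ k* → divFloor n k* ≤ C* x
    ⌊n/k*⌋≤C* x 1≤x x≤k* = divFloor≤ n k* (C* x) (begin-strict
      n                                   ≡⟨ ∑C*≡n ⟨
      ∑ (range1 k*) C*                    <⟨ ∑-mono-< (range1 k*) (range1⁺ 1≤x x≤k*) C*≤ ≤-refl ⟩
      ∑ (range1 k*) (λ _ → suc (C* x))    ≡⟨ ∑-const (range1 k*) (suc (C* x)) ⟩
      length (range1 k*) * suc (C* x)     ≡⟨ cong (_* suc (C* x)) (length-range1 k*) ⟩
      k* * suc (C* x)                     ≡⟨ *-comm k* (suc (C* x)) ⟩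
      suc (C* x) * k*                     ∎)
      where
      open ≤-Reasoning
      C*≤ : ∀ y → y ∈ range1 k* → C* y ≤ suc (C* x)
      C*≤ y y∈ = c*-balanced y x (proj₁ (range1⁻ y∈)) (proj₂ (range1⁻ y∈)) 1≤x x≤k*

    -- Every class of c* has at most ⌈n/K⌉ vertices, for any 1 ≤ K ≤ k*:
    -- if |C*_x| = m + 1 then all classes have ≥ m vertices, so n ≥ k*·m + 1.
    C*≤⌈n/K⌉ : ∀ x → 1 ≤ x → x ≤ k* → ∀ K → 1 ≤ K → K ≤ k* → C* x ≤ divCeil n K
    C*≤⌈n/K⌉ x 1≤x x≤k* K 1≤K K≤k* with C* x in C*x≡
    ... | zero   = z≤n
    ... | suc m  = ≤divCeil n K (suc m) 1≤K (bound K 1≤K K≤k*)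
      where
      m≤C* : ∀ y → y ∈ range1 k* → m ≤ C* y
      m≤C* y y∈ = ≤-pred (subst (_≤ suc (C* y)) C*x≡
                    (c*-balanced x y 1≤x x≤k* (proj₁ (range1⁻ y∈)) (proj₂ (range1⁻ y∈))))
      k*m<n : k* * m < n
      k*m<n = begin-strict
        k* * m                       ≡⟨ cong (_* m) (length-range1 k*) ⟨
        length (range1 k*) * m       ≡⟨ ∑-const (range1 k*) m ⟨
        ∑ (range1 k*) (λ _ → m)      <⟨ ∑-mono-< (range1 k*) (range1⁺ 1≤x x≤k*) m≤C* (≤-reflexive (sym C*x≡)) ⟩
        ∑ (range1 k*) C*             ≡⟨ ∑C*≡n ⟩
        n                            ∎
        where open ≤-Reasoning
      bound : ∀ K → 1 ≤ K → K ≤ k* → suc m * K ≤ n + (K ∸ 1)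
      bound (suc K′) _ K≤k* = begin
        suc K′ + m * suc K′   ≤⟨ +-monoʳ-≤ (suc K′) (≤-trans (*-monoʳ-≤ m K≤k*) (≤-reflexive (*-comm m k*))) ⟩
        suc K′ + k* * m       ≡⟨ +-suc K′ (k* * m) ⟨
        K′ + suc (k* * m)     ≤⟨ +-monoʳ-≤ K′ k*m<n ⟩
        K′ + n                ≡⟨ +-comm K′ n ⟩
        n + K′                ∎
        where open ≤-Reasoning

  -- Partial colourings compatible with a fixed equitable k*-colouring c*:
  -- every class C_j of Π lies inside the class C*_{σ j} of c*, for a
  -- relabelling σ that is injective on [1..k].  Such a Π can always be
  -- extended compatibly, and while UB > k* it passes all tests of Step 3.
  module Compatibility {c* : Fin n → ℕ} {k* : ℕ} (eqCol : IsEqCol G k* c*) where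
    open EquitableCounting eqCol

    record Compatible (Π : PCol n) : Set where
      field
        shaped    : Shaped Π
        relabel   : ℕ → ℕ
        agrees    : ∀ v → col Π v ≢ 0 → c* v ≡ relabel (col Π v)
        injective : InjectiveOn (k Π) relabel
      open Shaped shaped public

    module _ {Π : PCol n} (compat : Compatible Π) where
      open Compatible compat

      class⊆ : ∀ v r → 1 ≤ r → col Π v ≡ r → c* v ≡ relabel r
      class⊆ v r 1≤r cv≡r = trans (agrees v (λ cv≡0 → n>0⇒n≢0 1≤r (trans (sym cv≡r) cv≡0))) (cong relabel cv≡r)

      -- σ maps [1..k] into [1..k*], as each class C_r is non-empty.
      relabel-into : MapsInto (k Π) k* relabel
      relabel-into i 1≤i i≤k with nonEmpty i 1≤i i≤k
      ... | v , cv≡i = subst (λ x → 1 ≤ x × x ≤ k*) (class⊆ v i 1≤i cv≡i) (c*-range v)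

      k≤k* : k Π ≤ k*
      k≤k* = pigeonhole (k Π) k* relabel relabel-into injective

      |C|≤|C*| : ∀ r → 1 ≤ r → classSize (col Π) r ≤ C* (relabel r)
      |C|≤|C*| r 1≤r = begin
        classSize (col Π) r                         ≡⟨ classSize-∑ (col Π) r ⟩
        ∑ (allFin n) (λ v → 𝟙 (col Π v ≟ r))       ≤⟨ ∑-mono (allFin n) (λ v _ →
                                                        𝟙-mono (col Π v ≟ r) (c* v ≟ relabel r) (class⊆ v r 1≤r)) ⟩
        ∑ (allFin n) (λ v → 𝟙 (c* v ≟ relabel r))  ≡⟨ classSize-∑ c* (relabel r) ⟨
        C* (relabel r)                              ∎
        where open ≤-Reasoning

      Missing : ℕ → Fin n → Set
      Missing r v = c* v ≡ relabel r × col Π v ≡ 0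

      missing? : ∀ r v → Dec (Missing r v)
      missing? r v = (c* v ≟ relabel r) ×-dec (col Π v ≟ 0)

      missing : ℕ → ℕ
      missing r = ∑ (allFin n) (λ v → 𝟙 (missing? r v))

      -- C*_{σ r} ⊆ C_r ∪ U, because a coloured vertex of C*_{σ r} lies in
      -- a class relabelled to σ r, which is C_r by injectivity.
      |C*|≤|C|+missing : ∀ r → 1 ≤ r → r ≤ k Π → C* (relabel r) ≤ classSize (col Π) r + missing r
      |C*|≤|C|+missing r 1≤r r≤k = begin
        C* (relabel r)                                          ≡⟨ classSize-∑ c* (relabel r) ⟩
        ∑ (allFin n) (λ v → 𝟙 (c* v ≟ relabel r))              ≤⟨ ∑-mono (allFin n) (λ v _ →
                                    𝟙-split (c* v ≟ relabel r) (col Π v ≟ r) (missing? r v) (split v)) ⟩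
        ∑ (allFin n) (λ v → 𝟙 (col Π v ≟ r) + 𝟙 (missing? r v)) ≡⟨ ∑-+ (allFin n) _ _ ⟩
        ∑ (allFin n) (λ v → 𝟙 (col Π v ≟ r)) + missing r       ≡⟨ cong (_+ missing r) (classSize-∑ (col Π) r) ⟨
        classSize (col Π) r + missing r                         ∎
        where
        open ≤-Reasoning
        split : ∀ v → c* v ≡ relabel r → col Π v ≡ r ⊎ Missing r v
        split v c*v≡σr with col Π v ≟ 0
        ... | yes cv≡0 = inj₂ (c*v≡σr , cv≡0)
        ... | no cv≢0  = inj₁ (injective (col Π v) r (n≢0⇒n>0 cv≢0) (bounded v) 1≤r r≤k
                                         (trans (sym (agrees v cv≢0)) c*v≡σr))

      -- The missing parts of distinct classes are disjoint subsets of U.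
      ∑missing≤|U| : ∑ (range1 (k Π)) missing ≤ classSize (col Π) 0
      ∑missing≤|U| = begin
        ∑ (range1 (k Π)) missing                                    ≡⟨ ∑-swap (range1 (k Π)) (allFin n) _ ⟩
        ∑ (allFin n) (λ v → ∑ (range1 (k Π)) (λ r → 𝟙 (missing? r v))) ≤⟨ ∑-mono (allFin n) (λ v _ → atMostOnce v) ⟩
        ∑ (allFin n) (λ v → 𝟙 (col Π v ≟ 0))                      ≡⟨ classSize-∑ (col Π) 0 ⟨
        classSize (col Π) 0                                         ∎
        where
        open ≤-Reasoning
        atMostOnce : ∀ v → ∑ (range1 (k Π)) (λ r → 𝟙 (missing? r v)) ≤ 𝟙 (col Π v ≟ 0)
        atMostOnce v = ≤𝟙 (col Π v ≟ 0)
          (λ _ → ∑-atMostOne (range1 (k Π)) _ (unique-range1 (k Π)) (λ r → 𝟙≤1 (missing? r v)) sameClass)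
          (λ cv≢0 → ≤-reflexive (∑-zero (range1 (k Π)) _ (λ r _ → 𝟙-no (missing? r v) (λ m → cv≢0 (proj₂ m)))))
          where
          sameClass : ∀ r r′ → r ∈ range1 (k Π) → r′ ∈ range1 (k Π) →
                      𝟙 (missing? r v) ≡ 1 → 𝟙 (missing? r′ v) ≡ 1 → r ≡ r′
          sameClass r r′ r∈ r′∈ hit hit′ =
            injective r r′ (proj₁ (range1⁻ r∈)) (proj₂ (range1⁻ r∈)) (proj₁ (range1⁻ r′∈)) (proj₂ (range1⁻ r′∈))
              (trans (sym (proj₁ (𝟙≡1⇒ (missing? r v) hit))) (proj₁ (𝟙≡1⇒ (missing? r′ v) hit′)))

      maxClass≤ : ∀ {b} → (∀ r → 1 ≤ r → r ≤ k Π → C* (relabel r) ≤ b) → maxClass G Π ≤ b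
      maxClass≤ {b} C*≤b = maxList-least _ bound
        where
        bound : ∀ y → y ∈ map (classSize (col Π)) (range1 (k Π)) → y ≤ b
        bound y y∈ with ∈-map⁻ (classSize (col Π)) y∈
        ... | r , r∈ , refl = let (1≤r , r≤k) = range1⁻ r∈ in ≤-trans (|C|≤|C*| r 1≤r) (C*≤b r 1≤r r≤k)

      -- (P.1) holds for UB > k*: each deficit (T − |C_r|)⁺ is at most missing r,
      -- since T = max(M − 1, ⌊n/(UB−1)⌋) ≤ |C*_{σ r}| by equitability of c*.
      compatible⇒P1 : ∀ ub → k* < ub → P1 G ub Π
      compatible⇒P1 ub k*<ub = ≤-trans (∑-mono (range1 (k Π)) deficit≤missing) ∑missing≤|U|
        where
        T : ℕ
        T = (maxClass G Π ∸ 1) ⊔ divFloor n (ub ∸ 1)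
        deficit≤missing : ∀ r → r ∈ range1 (k Π) → T ∸ classSize (col Π) r ≤ missing r
        deficit≤missing r r∈ = m≤n+o⇒m∸n≤o T _ (≤-trans T≤C* (|C*|≤|C|+missing r 1≤r r≤k))
          where
          1≤r = proj₁ (range1⁻ r∈)
          r≤k = proj₂ (range1⁻ r∈)
          1≤σr = proj₁ (relabel-into r 1≤r r≤k)
          σr≤k* = proj₂ (relabel-into r 1≤r r≤k)
          M≤1+C* : maxClass G Π ≤ suc (C* (relabel r))
          M≤1+C* = maxClass≤ (λ r′ 1≤r′ r′≤k → let (1≤σr′ , σr′≤k*) = relabel-into r′ 1≤r′ r′≤k in
                     c*-balanced (relabel r′) (relabel r) 1≤σr′ σr′≤k* 1≤σr σr≤k*)
          T≤C* : T ≤ C* (relabel r)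
          T≤C* = ⊔-lub (m≤n+o⇒m∸n≤o _ 1 M≤1+C*)
                       (≤-trans (divFloor-antitone n (≤-trans 1≤σr σr≤k*) (<⇒≤∸1 k*<ub))
                                (⌊n/k*⌋≤C* (relabel r) 1≤σr σr≤k*))

      -- (P.2) holds for LB ≤ k*: |C_r| ≤ |C*_{σ r}| ≤ ⌈n/k*⌉ ≤ ⌈n/max(k, LB)⌉.
      compatible⇒P2 : ∀ lb → lb ≤ k* → P2 G lb Π
      compatible⇒P2 lb lb≤k* = maxClass≤ (λ r 1≤r r≤k → let (1≤σr , σr≤k*) = relabel-into r 1≤r r≤k in
        C*≤⌈n/K⌉ (relabel r) 1≤σr σr≤k* (k Π ⊔ lb) (≤-trans (≤-trans 1≤r r≤k) (m≤m⊔n (k Π) lb)) (⊔-lub k≤k* lb≤k*))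

      -- F(v) ≠ ∅ for uncoloured v: the class relabelled to c*(v) is free for v
      -- (c* is proper), and otherwise k+1 ≤ k* ≤ n is a new free colour.
      compatible⇒FNonempty : ∀ v → col Π v ≡ 0 → FNonempty G Π v
      compatible⇒FNonempty v _ with preimage? (k Π) relabel (c* v)
      ... | yes (r , 1≤r , r≤k , σr≡c*v) = r , 1≤r , ≤-trans r≤k (≤-trans k≤k* k*≤n) , notAdjacent
        where
        notAdjacent : ∀ w → col Π w ≡ r → ¬ Adj v w
        notAdjacent w cw≡r v~w = c*-proper v w v~w (trans (sym σr≡c*v) (sym (class⊆ w r 1≤r cw≡r)))
      ... | no none = suc (k Π) , s≤s z≤n , ≤-trans k+1≤k* k*≤n ,
                      (λ w cw≡k+1 _ → 1+n≰n (subst (_≤ k Π) cw≡k+1 (bounded w)))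
        where
        k+1≤k* : suc (k Π) ≤ k*
        k+1≤k* = pigeonhole (suc (k Π)) k* (extend relabel (k Π) (c* v))
                   (extend-into relabel (k Π) k* (c* v) relabel-into (c*-range v))
                   (extend-injective relabel (k Π) (c* v) injective none)

    -- Π_Q is compatible with c*: relabel i to c*(v_i), which is injective
    -- because the vertices of the clique Q receive distinct colours under c*.
    compatible-root : ∀ {Q} → Unique Q → Clique Q → Compatible (PiQ Q)
    compatible-root {Q} uniq clique = record
      { shaped    = shaped-root uniq
      ; relabel   = relabelQ c* Q
      ; agrees    = relabelQ-agrees c* Q
      ; injective = injective
      }
      where
      injective : InjectiveOn (length Q) (relabelQ c* Q)
      injective i j 1≤i i≤q 1≤j j≤q σi≡σj
        with indexOf-onto Q uniq i 1≤i i≤q | indexOf-onto Q uniq j 1≤j j≤q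
      ... | vᵢ , vᵢ∈Q , refl | vⱼ , vⱼ∈Q , refl with vᵢ Fin.≟ vⱼ
      ...   | yes refl  = refl
      ...   | no vᵢ≢vⱼ = ⊥-elim (c*-proper vᵢ vⱼ (clique vᵢ∈Q vⱼ∈Q vᵢ≢vⱼ)
                  (trans (relabelQ-agrees c* Q vᵢ (n>0⇒n≢0 1≤i))
                    (trans σi≡σj (sym (relabelQ-agrees c* Q vⱼ (n>0⇒n≢0 1≤j))))))

    -- The branch the search must follow to stay compatible with c*.
    record CompatibleBranch (Π : PCol n) (u : Fin n) : Set where
      field
        colour     : ℕ
        1≤colour   : 1 ≤ colour
        colour≤k+1 : colour ≤ suc (k Π)
        joins      : ∀ w → col Π w ≡ colour → c* w ≡ c* u
        compatible : Compatible (assign u colour Π)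

    agrees-assign : ∀ {Π : PCol n} {u j} (σ σ′ : ℕ → ℕ) → Shaped Π →
                    (∀ v → col Π v ≢ 0 → c* v ≡ σ (col Π v)) → (∀ i → i ≤ k Π → σ′ i ≡ σ i) → c* u ≡ σ′ j →
                    ∀ v → col (assign u j Π) v ≢ 0 → c* v ≡ σ′ (col (assign u j Π) v)
    agrees-assign {Π} {u} {j} σ σ′ shaped agrees σ′≡σ c*u≡ v c′v≢0 = byCase (v Fin.≟ u)
      where
      open Shaped shaped
      byCase : Dec (v ≡ u) → c* v ≡ σ′ (col (assign u j Π) v)
      byCase (yes refl) = trans c*u≡ (cong σ′ (sym (assign-at u j Π)))
      byCase (no v≢u)   =
        let cv≢0 = λ cv≡0 → c′v≢0 (trans (assign-elsewhere u j Π v≢u) cv≡0) in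
        trans (agrees v cv≢0) (trans (sym (σ′≡σ (col Π v) (bounded v))) (cong σ′ (sym (assign-elsewhere u j Π v≢u))))

    -- Put u into the class relabelled to c*(u) if there is one; otherwise
    -- open the new class k+1 and relabel it to c*(u).
    compatible-branch : ∀ {Π u} → Compatible Π → col Π u ≡ 0 → CompatibleBranch Π u
    compatible-branch {Π} {u} compat u-uncol with preimage? (k Π) (Compatible.relabel compat) (c* u)
    ... | yes (r , 1≤r , r≤k , σr≡c*u) = record
      { colour     = r
      ; 1≤colour   = 1≤r
      ; colour≤k+1 = m≤n⇒m≤1+n r≤k
      ; joins      = λ w cw≡r → trans (class⊆ compat w r 1≤r cw≡r) σr≡c*u
      ; compatible = record
        { shaped    = shaped-assign shaped u-uncol 1≤r (m≤n⇒m≤1+n r≤k)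
        ; relabel   = relabel
        ; agrees    = agrees-assign relabel relabel shaped agrees (λ _ _ → refl) (sym σr≡c*u)
        ; injective = subst (λ K → InjectiveOn K relabel) (sym (m≥n⇒m⊔n≡m r≤k)) injective
        }
      }
      where open Compatible compat
    ... | no none = record
      { colour     = suc (k Π)
      ; 1≤colour   = s≤s z≤n
      ; colour≤k+1 = ≤-refl
      ; joins      = λ w cw≡k+1 → ⊥-elim (1+n≰n (subst (_≤ k Π) cw≡k+1 (bounded w)))
      ; compatible = record
        { shaped    = shaped-assign shaped u-uncol (s≤s z≤n) ≤-refl
        ; relabel   = σ′
        ; agrees    = agrees-assign relabel σ′ shaped agrees (extend-old relabel (k Π) (c* u))
                                    (sym (extend-new relabel (k Π) (c* u)))
        ; injective = subst (λ K → InjectiveOn K σ′) (sym (m≤n⇒m⊔n≡n (n≤1+n (k Π))))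
                            (extend-injective relabel (k Π) (c* u) injective none)
        }
      }
      where
      open Compatible compat
      σ′ : ℕ → ℕ
      σ′ = extend relabel (k Π) (c* u)

  module Search (lb : ℕ) (R : Rule G) (validR : ValidRule G R) where
    open Semantics G lb R
    open Rule R

    selUncoloured : ∀ s Π → ¬ AllColored G Π → col Π (sel s Π) ≡ 0
    selUncoloured = proj₁ validR

    -- A child that passes the tests of Step 3 is valid again; its
    -- equitability at the leaves comes from (P.1).
    valid-assign : ∀ {Π u j s} → Valid Π → col Π u ≡ 0 → Cond Π u j s → Valid (assign u j Π)
    valid-assign {Π} {u} {j} {s} valid u-uncol (1≤j , j≤ , j∈F , _ , p1 , _) = record
      { shaped    = shaped-assign shaped u-uncol 1≤j (≤-trans j≤ (m⊓n≤m _ _))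
      ; proper    = proper-assign {Π} {u} {j} proper j∈F
      ; equitable = P1⇒equitable {UB s} (assign u j Π) p1
      }
      where open Valid valid

    EqColState : State n → Set
    EqColState s = IsEqCol G (UB s) (cbar s)

    mutual
      sound : ∀ {Π s s′} → Valid Π → EqColState s → Node Π s s′ → EqColState s′
      sound valid _ (leaf all) = valid⇒eqCol valid all
      sound {Π} {s} valid ok (branch notAll loop) = soundLoop valid (selUncoloured s Π notAll) ok loop

      soundLoop : ∀ {Π u js s s′} → Valid Π → col Π u ≡ 0 → EqColState s → Loop Π u js s s′ → EqColState s′
      soundLoop valid u-uncol ok stop                 = ok
      soundLoop valid u-uncol ok (skip _ loop)        = soundLoop valid u-uncol ok loop
      soundLoop {s = s} valid u-uncol ok (call cond node loop) =
        soundLoop valid u-uncol (sound (valid-assign {s = s} valid u-uncol cond) ok node) loop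

    -- A child called in Step 3 uses at most UB colours (since j ≤ UB − 1).
    child-k≤UB : ∀ {Π u j s} → Cond Π u j s → k Π ≤ UB s → k Π ⊔ j ≤ UB s
    child-k≤UB {s = s} (_ , j≤ , _) k≤UB = ⊔-lub k≤UB (≤-trans j≤ (≤-trans (m⊓n≤n _ _) (m∸n≤m (UB s) 1)))

    mutual
      ub-decreases : ∀ {Π s s′} → k Π ≤ UB s → Node Π s s′ → k Π ≤ UB s′ × UB s′ ≤ UB s
      ub-decreases k≤UB (leaf _)        = ≤-refl , k≤UB
      ub-decreases k≤UB (branch _ loop) = ub-decreasesLoop k≤UB loop

      ub-decreasesLoop : ∀ {Π u js s s′} → k Π ≤ UB s → Loop Π u js s s′ → k Π ≤ UB s′ × UB s′ ≤ UB s
      ub-decreasesLoop k≤UB stop          = k≤UB , ≤-refl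
      ub-decreasesLoop k≤UB (skip _ loop) = ub-decreasesLoop k≤UB loop
      ub-decreasesLoop {Π} {s = s} k≤UB (call {j = j} cond node loop) =
        let (k′≤UB′ , UB′≤UB)  = ub-decreases (child-k≤UB {s = s} cond k≤UB) node
            (k≤UB″ , UB″≤UB′) = ub-decreasesLoop (≤-trans (m≤m⊔n (k Π) j) k′≤UB′) loop
        in k≤UB″ , ≤-trans UB″≤UB′ UB′≤UB

    inF? : ∀ Π u j → Dec (InF G Π u j)
    inF? Π u j = (1 ≤? j) ×-dec (j ≤? n) ×-dec Finₚ.all? (λ w → (col Π w ≟ j) →-dec ¬? (adj? u w))

    fNonempty? : ∀ Π v → Dec (FNonempty G Π v)
    fNonempty? Π v = map′ (λ (j , _ , j∈F) → j , j∈F) (λ (j , j∈F) → j , s≤s (proj₁ (proj₂ j∈F)) , j∈F)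
                          (anyUpTo? (inF? Π v) (suc n))

    cond? : ∀ Π u j s → Dec (Cond Π u j s)
    cond? Π u j s = (1 ≤? j) ×-dec (j ≤? suc (k Π) ⊓ (UB s ∸ 1)) ×-dec inF? Π u j
      ×-dec Finₚ.all? (λ v → (col (assign u j Π) v ≟ 0) →-dec fNonempty? (assign u j Π) v)
      ×-dec (_ ≤? _) ×-dec (_ ≤? _)

    allColoured? : ∀ Π → Dec (AllColored G Π)
    allColoured? Π = Finₚ.all? (λ v → ¬? (col Π v ≟ 0))

    -- Termination: from any partial colouring and any global state the
    -- recursion produces a final state; the fuel bounds |U|, which
    -- strictly decreases at every recursive call.
    mutual
      run : ∀ fuel Π → classSize (col Π) 0 < fuel → ∀ s → Σ (State n) (Node Π s)
      run (suc fuel) Π |U|<fuel s with allColoured? Π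
      ... | yes all   = state (k Π) (col Π) , leaf all
      ... | no notAll =
        let (s′ , loop) = runLoop fuel Π (sel s Π) (selUncoloured s Π notAll) (≤-pred |U|<fuel) (ord s Π (sel s Π)) s
        in s′ , branch notAll loop

      runLoop : ∀ fuel Π u → col Π u ≡ 0 → classSize (col Π) 0 ≤ fuel → ∀ js s → Σ (State n) (Loop Π u js s)
      runLoop fuel Π u u-uncol |U|≤fuel []       s = s , stop
      runLoop fuel Π u u-uncol |U|≤fuel (j ∷ js) s with cond? Π u j s
      ... | no ¬cond =
        let (s′ , loop) = runLoop fuel Π u u-uncol |U|≤fuel js s in s′ , skip ¬cond loop
      ... | yes cond =
        let (s′ , node) = run fuel (assign u j Π) (≤-trans (uncoloured-decreases {Π = Π} u-uncol (proj₁ cond)) |U|≤fuel) s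
            (s″ , loop) = runLoop fuel Π u u-uncol |U|≤fuel js s′
        in s″ , call cond node loop

    -- Optimality with respect to a fixed equitable k*-colouring c* with LB ≤ k*:
    -- as long as UB > k*, the compatible branch is explored, so the search
    -- ends with UB ≤ k*.
    module Optimality {c* : Fin n → ℕ} {k* : ℕ} (eqCol : IsEqCol G k* c*) (lb≤k* : lb ≤ k*) where
      open EquitableCounting eqCol
      open Compatibility eqCol
      open CompatibleBranch

      branch-passes : ∀ {Π u} (b : CompatibleBranch Π u) → ∀ s → k* < UB s → Cond Π u (colour b) s
      branch-passes {Π} {u} b s k*<UB =
          1≤colour b , ⊓-glb (colour≤k+1 b) (≤-trans j≤k* (<⇒≤∸1 k*<UB))
        , (1≤colour b , ≤-trans j≤k* k*≤n , notAdjacent)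
        , compatible⇒FNonempty (compatible b)
        , compatible⇒P1 (compatible b) (UB s) k*<UB
        , compatible⇒P2 (compatible b) lb lb≤k*
        where
        j≤k* : colour b ≤ k*
        j≤k* = ≤-trans (m≤n⊔m (k Π) (colour b)) (k≤k* (compatible b))
        notAdjacent : ∀ w → col Π w ≡ colour b → ¬ Adj u w
        notAdjacent w cw≡j u~w = c*-proper u w u~w (sym (joins b w cw≡j))

      stays-below : ∀ {Π u js s s′} → k Π ≤ UB s → UB s ≤ k* → Loop Π u js s s′ → UB s′ ≤ k*
      stays-below k≤UB UB≤k* loop = ≤-trans (proj₂ (ub-decreasesLoop k≤UB loop)) UB≤k*

      mutual
        reaches : ∀ {Π s s′} → Compatible Π → k* < UB s → k Π ≤ UB s → Node Π s s′ → UB s′ ≤ k*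
        reaches compat _ _ (leaf _) = k≤k* compat
        reaches {Π} {s} compat k*<UB k≤UB (branch notAll loop) =
          reachesLoop b (∈-resp-↭ (↭-sym (proj₂ validR s Π u)) (range1⁺ (1≤colour b) (colour≤k+1 b))) k*<UB k≤UB loop
          where
          u = sel s Π
          b = compatible-branch compat (selUncoloured s Π notAll)

        reachesLoop : ∀ {Π u js s s′} (b : CompatibleBranch Π u) → colour b ∈ js →
                      k* < UB s → k Π ≤ UB s → Loop Π u js s s′ → UB s′ ≤ k*
        reachesLoop {s = s} b (here refl) k*<UB _ (skip ¬cond _) = ⊥-elim (¬cond (branch-passes b s k*<UB))
        reachesLoop b (there j∈)  k*<UB k≤UB (skip _ loop) = reachesLoop b j∈ k*<UB k≤UB loop
        reachesLoop {Π} {s = s} b (here refl) k*<UB k≤UB (call cond node loop) =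
          let k′≤UB = child-k≤UB {s = s} cond k≤UB in
          stays-below (≤-trans (m≤m⊔n (k Π) _) (proj₁ (ub-decreases k′≤UB node)))
                      (reaches (compatible b) k*<UB k′≤UB node) loop
        reachesLoop {Π} {s = s} b (there j∈) k*<UB k≤UB (call {s′ = s₁} cond node loop)
          with k≤UB₁ ← ≤-trans (m≤m⊔n (k Π) _) (proj₁ (ub-decreases (child-k≤UB {s = s} cond k≤UB) node))
          with k* <? UB s₁
        ... | yes k*<UB₁ = reachesLoop b j∈ k*<UB₁ k≤UB₁ loop
        ... | no  k*≮UB₁ = stays-below k≤UB₁ (≮⇒≥ k*≮UB₁) loop

mainTheorem3 : ∀ {n} (G : Graph n) → 1 ≤ n
    → (UB₀ : ℕ) (c₀ : Fin n → ℕ) → IsEqCol G UB₀ c₀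
    → (LB : ℕ) → (∀ k → EqColorable G k → LB ≤ k)
    → (Q : List (Fin n)) → IsMaximalClique G Q
    → (R : Rule G) → ValidRule G R
    → Σ (State n) (λ s → Semantics.Node G LB R (PiQ Q) (state UB₀ c₀) s)
      × (∀ s → Semantics.Node G LB R (PiQ Q) (state UB₀ c₀) s
           → IsChiEq G (UB s) × IsEqCol G (UB s) (cbar s))
mainTheorem3 {n} G _ UB₀ c₀ c₀-eqCol LB LB≤χ Q (uniq , clique , _) R validR =
    run (suc (classSize (indexOf Q) 0)) (PiQ Q) ≤-refl (state UB₀ c₀)
  , λ s node → let eqCol = sound (valid-root G uniq) c₀-eqCol node in
               ((cbar s , eqCol) , optimal s node) , eqCol
  where
  open Search G LB R validR

  compatible-root : ∀ {c* k*} (eqCol : IsEqCol G k* c*) → Compatibility.Compatible G eqCol (PiQ Q)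
  compatible-root eqCol = Compatibility.compatible-root G eqCol uniq clique

  -- Hence Π_Q uses at most UB₀ colours, as the search requires of every node.
  q≤UB₀ : length Q ≤ UB₀
  q≤UB₀ = Compatibility.k≤k* G c₀-eqCol (compatible-root c₀-eqCol)

  -- UB ends below every k′ admitting a k′-eqcol: below UB₀ by optimality,
  -- otherwise because UB never increases.
  optimal : ∀ s → Semantics.Node G LB R (PiQ Q) (state UB₀ c₀) s → ∀ k′ → EqColorable G k′ → UB s ≤ k′
  optimal s node k′ (c′ , c′-eqCol) with k′ <? UB₀
  ... | yes k′<UB₀ = Optimality.reaches c′-eqCol (LB≤χ k′ (c′ , c′-eqCol))
                       (compatible-root c′-eqCol) k′<UB₀ q≤UB₀ node
  ... | no  k′≮UB₀ = ≤-trans (proj₂ (ub-decreases q≤UB₀ node)) (≮⇒≥ k′≮UB₀)
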